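{- For integers $0\le a\le n$, \[ \sum_{l=0}^{a}(1-l)\,e_l\,X_{P_{n-l}}=\begin{cases}X_{K_{a+1}^{\,n-1-a}}\big/a!, & \text{if } a\le n-1,\\ e_n, & \text{if } a=n.\end{cases} \]
   Context: $X_G=\sum_{\kappa}\prod_{v\in V(G)}x_{\kappa(v)}$, summed over proper colorings $\kappa:V(G)\to\{1,2,\dots\}$, is the chromatic symmetric function of a finite simple graph $G$; $e_l$ is the $l$-th elementary symmetric function, $e_0=1$. $P_i$ is the path on $i$ vertices, with $P_0$ the empty graph and $X_{P_0}=1$. The lollipop $K_m^l$ is the complete graph $K_m$ with a path of length $l$ ($l$ new vertices) attached at one of its vertices. -}

module Defs where

open import Data.Bool using (Bool; true; false; _∧_; _∨_; not; if_then_else_)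
open import Data.Nat as ℕ using (ℕ; zero; suc; _+_; _∸_; _≡ᵇ_; _<ᵇ_; _≤ᵇ_)
open import Data.Integer as ℤ using (ℤ; +_; 0ℤ; 1ℤ)
open import Data.Fin as Fin using (Fin; toℕ)
open import Data.Vec as Vec using (Vec; []; _∷_; lookup; zipWith)
open import Data.List as List using (List; []; _∷_; map; concatMap; allFin; upTo; all; foldr)
open import Relation.Nullary.Decidable using (⌊_⌋)
open import Relation.Binary.PropositionalEquality using (_≡_)

-- Symmetric functions, truncated to N variables x_0 … x_{N-1}.
-- A polynomial in N variables with integer coefficients is given by its
-- coefficient function on exponent vectors (monomials) α ∈ ℕ^N.

Poly : ℕ → Set
Poly N = Vec ℕ N → ℤ

_≈P_ : ∀ {N} → Poly N → Poly N → Set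
f ≈P g = ∀ α → f α ≡ g α

sumℤ : List ℤ → ℤ
sumℤ = foldr ℤ._+_ 0ℤ

sumℕ : List ℕ → ℕ
sumℕ = foldr _+_ 0

below : ∀ {N} → Vec ℕ N → List (Vec ℕ N)
below []      = [] ∷ []
below (a ∷ α) = concatMap (λ b → map (b ∷_) (below α)) (upTo (suc a))

_*P_ : ∀ {N} → Poly N → Poly N → Poly N
(f *P g) α = sumℤ (map (λ β → f β ℤ.* g (zipWith _∸_ α β)) (below α))

_+P_ : ∀ {N} → Poly N → Poly N → Poly N
(f +P g) α = f α ℤ.+ g α

0P : ∀ {N} → Poly N
0P _ = 0ℤ

_·P_ : ∀ {N} → ℤ → Poly N → Poly N
(c ·P f) α = c ℤ.* f α

e : ℕ → (N : ℕ) → Poly N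
e l N α =
  if all (λ k → k ≤ᵇ 1) (Vec.toList α) ∧ (sumℕ (Vec.toList α) ≡ᵇ l)
  then 1ℤ else 0ℤ

record Graph : Set where
  field
    size : ℕ
    adj  : Fin size → Fin size → Bool
open Graph public

colourings : (N k : ℕ) → List (Vec (Fin N) k)
colourings N zero    = [] ∷ []
colourings N (suc k) = concatMap (λ c → map (c ∷_) (colourings N k)) (allFin N)

_==F_ : ∀ {n} → Fin n → Fin n → Bool
i ==F j = ⌊ i Fin.≟ j ⌋

proper : (G : Graph) → ∀ {N} → Vec (Fin N) (size G) → Bool
proper G κ = all (λ i → all (λ j → not (adj G i j ∧ (lookup κ i ==F lookup κ j)))
                           (allFin (size G)))
                 (allFin (size G))

mult : ∀ {N k} → Vec (Fin N) k → Fin N → ℕ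
mult {k = k} κ j = sumℕ (map (λ i → if lookup κ i ==F j then 1 else 0) (allFin k))

hasMonomial : ∀ {N k} → Vec (Fin N) k → Vec ℕ N → Bool
hasMonomial {N} κ α = all (λ j → mult κ j ≡ᵇ lookup α j) (allFin N)

count : ∀ {A : Set} → (A → Bool) → List A → ℕ
count p xs = sumℕ (map (λ x → if p x then 1 else 0) xs)

X : Graph → (N : ℕ) → Poly N
X G N α = + count (λ κ → proper G κ ∧ hasMonomial κ α) (colourings N (size G))

-- Path P_i on vertices 0,…,i-1 (P_0 is the empty graph).

P : ℕ → Graph
P i = record { size = i ; adj = λ x y → (toℕ x ≡ᵇ suc (toℕ y)) ∨ (toℕ y ≡ᵇ suc (toℕ x)) }

-- Lollipop K_m^l: K_m on vertices 0,…,m-1, plus path m-1 — m — m+1 — … — m+l-1.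
Lollipop : ℕ → ℕ → Graph
Lollipop m l = record
  { size = m + l
  ; adj  = λ x y → not (toℕ x ≡ᵇ toℕ y) ∧
             (((toℕ x <ᵇ m) ∧ (toℕ y <ᵇ m)) ∨
              (((m ≤ᵇ toℕ x) ∨ (m ≤ᵇ toℕ y)) ∧
               ((toℕ x ≡ᵇ suc (toℕ y)) ∨ (toℕ y ≡ᵇ suc (toℕ x)))))
  }

lhs : (n a N : ℕ) → Poly N
lhs n a N = foldr (λ l acc → ((1ℤ ℤ.- + l) ·P (e l N *P X (P (n ∸ l)) N)) +P acc)
                  0P (upTo (suc a))

-- Work coefficientwise at a monomial x^α. The coefficient of x^α in e_l X_{P_k} counts
-- pairs (S, κ) of an l-set S of colours and a proper colouring κ of P_k with x^S x^κ = x^α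
-- (E_l(k), ePath with the weight w = δ α); let H_s(k) (ePathOutside) count those with
-- |S| = s whose first colour is not in S. Moving that first colour into S shows
-- H_s(k+1) = s E_{s+1}(k) + H_{s+1}(k): a pair (S', κ') with |S'| = s+1 arises once from
-- each c ∈ S' other than the first colour of κ'. Hence the alternating sum telescopes to
-- H_a(n-a). A proper colouring of K_{a+1}^{n-1-a} is an ordering of a set S of a colours on
-- the clique vertices off the path, followed by a colouring of P_{n-a} whose first colour
-- avoids S, so its count is a! H_a(n-a); and for a = n, H_n(0) is the coefficient of x^α in e_n.

module Submission where

open import Defs
open import Algebra.Bundles using (CommutativeMonoid)
open import Algebra.Properties.CommutativeSemigroup using (interchange)
open import Data.Bool using (Bool; true; false; _∧_; _∨_; not; if_then_else_; T)
import Data.Bool.Properties as BP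
import Data.Bool.ListAction as BL
open import Data.Nat using (ℕ; zero; suc; _+_; _*_; _∸_; _≡ᵇ_; _<ᵇ_; _≤ᵇ_; _!; _≤_; _<_; s≤s)
import Data.Nat.Properties as NP
open import Data.Integer as ℤ using (ℤ; 0ℤ; 1ℤ) renaming (+_ to pos)
import Data.Integer.Properties as ZP
open import Data.Integer.Tactic.RingSolver using (solve-∀)
open import Data.Fin as Fin using (Fin; toℕ)
open import Data.Vec as Vec using (Vec; []; _∷_; lookup; zipWith; replicate)
import Data.Vec.Properties as VP
open import Data.List as List using (List; []; _∷_; map; upTo; concatMap; _++_)
import Data.List.Properties as LP
open import Data.Nat.ListAction.Properties using (sum-++)
open import Data.Product using (_×_; _,_)
open import Relation.Nullary using (yes; no)
open import Relation.Binary.PropositionalEquality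
  using (_≡_; refl; sym; trans; cong; cong₂; subst; module ≡-Reasoning)
open ≡-Reasoning

private variable N k : ℕ

-- Guarded values and summation operators

when : Bool → ℕ → ℕ
when b x = if b then x else 0

when-∧ : ∀ a b x → when (a ∧ b) x ≡ when a (when b x)
when-∧ true  b x = refl
when-∧ false b x = refl

when-comm : ∀ a b x → when a (when b x) ≡ when b (when a x)
when-comm true  true  x = refl
when-comm true  false x = refl
when-comm false true  x = refl
when-comm false false x = refl

when-zero : ∀ b → when b 0 ≡ 0
when-zero true  = refl
when-zero false = refl

when-*ˡ : ∀ b c x → when b (c * x) ≡ c * when b x
when-*ˡ true  c x = refl
when-*ˡ false c x = sym (NP.*-zeroʳ c)

when≡*indicator : ∀ b x → when b x ≡ x * when b 1
when≡*indicator true  x = sym (NP.*-identityʳ x)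
when≡*indicator false x = sym (NP.*-zeroʳ x)

when-cong : ∀ b {x y} → (b ≡ true → x ≡ y) → when b x ≡ when b y
when-cong true  x≡y = x≡y refl
when-cong false x≡y = refl

when-+ : ∀ b x y → when b (x + y) ≡ when b x + when b y
when-+ true  x y = refl
when-+ false x y = refl

when-when≡* : ∀ a b x → when a (when b x) ≡ x * when a (when b 1)
when-when≡* true  true  x = sym (NP.*-identityʳ x)
when-when≡* true  false x = sym (NP.*-zeroʳ x)
when-when≡* false b     x = sym (NP.*-zeroʳ x)

+-interchange : ∀ a b c d → (a + b) + (c + d) ≡ (a + c) + (b + d)
+-interchange = interchange NP.+-commutativeSemigroup

∧-interchange : ∀ a b c d → (a ∧ b) ∧ (c ∧ d) ≡ (a ∧ c) ∧ (b ∧ d)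
∧-interchange = interchange (CommutativeMonoid.commutativeSemigroup BP.∧-commutativeMonoid)

≡ᵇ-true⇒≡ : ∀ {m n} → (m ≡ᵇ n) ≡ true → m ≡ n
≡ᵇ-true⇒≡ {m} {n} eq = NP.≡ᵇ⇒≡ m n (subst T (sym eq) _)

record IsSummation {A : Set} (∑ : (A → ℕ) → ℕ) : Set where
  field
    ∑-cong : ∀ {f g} → (∀ a → f a ≡ g a) → ∑ f ≡ ∑ g
    ∑-+    : ∀ f g → ∑ (λ a → f a + g a) ≡ ∑ f + ∑ g
    ∑-0    : ∑ (λ _ → 0) ≡ 0

  ∑-when : ∀ b f → ∑ (λ a → when b (f a)) ≡ when b (∑ f)
  ∑-when true  f = refl
  ∑-when false f = ∑-0

  ∑-*ˡ : ∀ c f → ∑ (λ a → c * f a) ≡ c * ∑ f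
  ∑-*ˡ zero    f = ∑-0
  ∑-*ˡ (suc c) f = trans (∑-+ f (λ a → c * f a)) (cong (∑ f +_) (∑-*ˡ c f))

open IsSummation public

∑Fin : (n : ℕ) → (Fin n → ℕ) → ℕ
∑Fin zero    f = 0
∑Fin (suc n) f = f Fin.zero + ∑Fin n (λ i → f (Fin.suc i))

∑Fin-isSummation : ∀ n → IsSummation (∑Fin n)
∑Fin-isSummation n = record { ∑-cong = cong′ n ; ∑-+ = +′ n ; ∑-0 = 0′ n }
  where
  cong′ : ∀ n {f g} → (∀ a → f a ≡ g a) → ∑Fin n f ≡ ∑Fin n g
  cong′ zero    f≗g = refl
  cong′ (suc n) f≗g = cong₂ _+_ (f≗g Fin.zero) (cong′ n (λ i → f≗g (Fin.suc i)))
  +′ : ∀ n f g → ∑Fin n (λ a → f a + g a) ≡ ∑Fin n f + ∑Fin n g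
  +′ zero    f g = refl
  +′ (suc n) f g = trans (cong (f Fin.zero + g Fin.zero +_) (+′ n _ _)) (+-interchange (f Fin.zero) (g Fin.zero) _ _)
  0′ : ∀ n → ∑Fin n (λ _ → 0) ≡ 0
  0′ zero    = refl
  0′ (suc n) = 0′ n

∑Fin-interchange : ∀ {A} {∑ : (A → ℕ) → ℕ} → IsSummation ∑ →
  ∀ n (f : Fin n → A → ℕ) → ∑Fin n (λ i → ∑ (f i)) ≡ ∑ (λ a → ∑Fin n (λ i → f i a))
∑Fin-interchange {∑ = ∑} S zero    f = sym (∑-0 S)
∑Fin-interchange {∑ = ∑} S (suc n) f =
  trans (cong (∑ (f Fin.zero) +_) (∑Fin-interchange S n (λ i → f (Fin.suc i)))) (sym (∑-+ S _ _))

∑Vec : ∀ {A : Set} → (k : ℕ) → ((A → ℕ) → ℕ) → (Vec A k → ℕ) → ℕ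
∑Vec zero    ∑ f = f []
∑Vec (suc k) ∑ f = ∑ (λ a → ∑Vec k ∑ (λ v → f (a ∷ v)))

∑Vec-isSummation : ∀ {A} {∑ : (A → ℕ) → ℕ} k → IsSummation ∑ → IsSummation (∑Vec k ∑)
∑Vec-isSummation {∑ = ∑} k S = record { ∑-cong = cong′ k ; ∑-+ = +′ k ; ∑-0 = 0′ k }
  where
  cong′ : ∀ k {f g} → (∀ a → f a ≡ g a) → ∑Vec k ∑ f ≡ ∑Vec k ∑ g
  cong′ zero    f≗g = f≗g []
  cong′ (suc k) f≗g = ∑-cong S (λ a → cong′ k (λ v → f≗g (a ∷ v)))
  +′ : ∀ k f g → ∑Vec k ∑ (λ a → f a + g a) ≡ ∑Vec k ∑ f + ∑Vec k ∑ g
  +′ zero    f g = refl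
  +′ (suc k) f g = trans (∑-cong S (λ a → +′ k _ _)) (∑-+ S _ _)
  0′ : ∀ k → ∑Vec k ∑ (λ _ → 0) ≡ 0
  0′ zero    = refl
  0′ (suc k) = trans (∑-cong S (λ _ → 0′ k)) (∑-0 S)

∑01 : (ℕ → ℕ) → ℕ
∑01 f = f 0 + f 1

∑01-isSummation : IsSummation ∑01
∑01-isSummation = record
  { ∑-cong = λ f≗g → cong₂ _+_ (f≗g 0) (f≗g 1)
  ; ∑-+    = λ f g → +-interchange (f 0) (g 0) (f 1) (g 1)
  ; ∑-0    = refl
  }

∑Colourings : (N k : ℕ) → (Vec (Fin N) k → ℕ) → ℕ
∑Colourings N k = ∑Vec k (∑Fin N)

∑Colourings-isSummation : ∀ N k → IsSummation (∑Colourings N k)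
∑Colourings-isSummation N k = ∑Vec-isSummation k (∑Fin-isSummation N)

-- subsets of the N colours, as 0/1-vectors
∑Subsets : (N : ℕ) → (Vec ℕ N → ℕ) → ℕ
∑Subsets N = ∑Vec N ∑01

∑Subsets-isSummation : ∀ N → IsSummation (∑Subsets N)
∑Subsets-isSummation N = ∑Vec-isSummation N ∑01-isSummation

∑List : ∀ {A : Set} → List A → (A → ℕ) → ℕ
∑List xs f = sumℕ (map f xs)

∑List-isSummation : ∀ {A : Set} (xs : List A) → IsSummation (∑List xs)
∑List-isSummation xs = record { ∑-cong = λ f≗g → cong sumℕ (LP.map-cong f≗g xs) ; ∑-+ = +′ xs ; ∑-0 = 0′ xs }
  where
  +′ : ∀ xs f g → ∑List xs (λ a → f a + g a) ≡ ∑List xs f + ∑List xs g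
  +′ []       f g = refl
  +′ (x ∷ xs) f g = trans (cong (f x + g x +_) (+′ xs f g)) (+-interchange (f x) (g x) _ _)
  0′ : ∀ xs → ∑List xs (λ _ → 0) ≡ 0
  0′ []       = refl
  0′ (x ∷ xs) = 0′ xs

∑List-map : ∀ {A B : Set} (g : A → B) (xs : List A) (f : B → ℕ) → ∑List (map g xs) f ≡ ∑List xs (λ x → f (g x))
∑List-map g xs f = cong sumℕ (sym (LP.map-∘ xs))

∑List-concatMap : ∀ {A B : Set} (g : A → List B) (xs : List A) (f : B → ℕ) →
  ∑List (concatMap g xs) f ≡ ∑List xs (λ x → ∑List (g x) f)
∑List-concatMap g []       f = refl
∑List-concatMap g (x ∷ xs) f = begin
  sumℕ (map f (g x ++ concatMap g xs))  ≡⟨ cong sumℕ (LP.map-++ f (g x) _) ⟩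
  sumℕ (map f (g x) ++ map f (concatMap g xs)) ≡⟨ sum-++ (map f (g x)) _ ⟩
  ∑List (g x) f + ∑List (concatMap g xs) f ≡⟨ cong (∑List (g x) f +_) (∑List-concatMap g xs f) ⟩
  ∑List (g x) f + ∑List xs (λ x → ∑List (g x) f) ∎

∑List-tabulate : ∀ {A : Set} n (g : Fin n → A) (f : A → ℕ) → ∑List (List.tabulate g) f ≡ ∑Fin n (λ i → f (g i))
∑List-tabulate zero    g f = refl
∑List-tabulate (suc n) g f = cong (f (g Fin.zero) +_) (∑List-tabulate n (λ i → g (Fin.suc i)) f)

∑List-colourings : ∀ N k (f : Vec (Fin N) k → ℕ) → ∑List (colourings N k) f ≡ ∑Colourings N k f
∑List-colourings N zero    f = NP.+-identityʳ (f [])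
∑List-colourings N (suc k) f = begin
  ∑List (concatMap (λ c → map (c ∷_) (colourings N k)) (List.allFin N)) f
    ≡⟨ ∑List-concatMap _ (List.allFin N) f ⟩
  ∑List (List.allFin N) (λ c → ∑List (map (c ∷_) (colourings N k)) f)
    ≡⟨ ∑List-tabulate N (λ i → i) _ ⟩
  ∑Fin N (λ c → ∑List (map (c ∷_) (colourings N k)) f)
    ≡⟨ ∑-cong (∑Fin-isSummation N) (λ c → trans (∑List-map (c ∷_) (colourings N k) f)
                                                (∑List-colourings N k (λ κ → f (c ∷ κ)))) ⟩
  ∑Colourings N (suc k) f ∎

-- Exponent vectors

==F-suc : ∀ {n} (i j : Fin n) → (Fin.suc i ==F Fin.suc j) ≡ (i ==F j)
==F-suc i j with i Fin.≟ j
... | yes _ = refl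
... | no  _ = refl

==F-sym : ∀ {n} (i j : Fin n) → (i ==F j) ≡ (j ==F i)
==F-sym Fin.zero    Fin.zero    = refl
==F-sym Fin.zero    (Fin.suc j) = refl
==F-sym (Fin.suc i) Fin.zero    = refl
==F-sym (Fin.suc i) (Fin.suc j) = trans (==F-suc i j) (trans (==F-sym i j) (sym (==F-suc j i)))

0ᵛ : Vec ℕ N
0ᵛ = replicate _ 0

infixl 6 _+ᵛ_
_+ᵛ_ : Vec ℕ N → Vec ℕ N → Vec ℕ N
_+ᵛ_ = zipWith _+_

𝟏 : Fin N → Vec ℕ N
𝟏 Fin.zero    = 1 ∷ 0ᵛ
𝟏 (Fin.suc c) = 0 ∷ 𝟏 c

degree : Vec ℕ N → ℕ
degree v = sumℕ (Vec.toList v)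

is01 : Vec ℕ N → Bool
is01 v = BL.all (_≤ᵇ 1) (Vec.toList v)

infix 4 _==ᵛ_ _≤ᵛ_
_==ᵛ_ : Vec ℕ N → Vec ℕ N → Bool
[]      ==ᵛ []      = true
(x ∷ u) ==ᵛ (y ∷ v) = (x ≡ᵇ y) ∧ (u ==ᵛ v)

_≤ᵛ_ : Vec ℕ N → Vec ℕ N → Bool
[]      ≤ᵛ []      = true
(x ∷ u) ≤ᵛ (y ∷ v) = (x ≤ᵇ y) ∧ (u ≤ᵛ v)

disjoint : Vec ℕ N → Vec ℕ N → Bool
disjoint []      []      = true
disjoint (x ∷ u) (y ∷ v) = ((x ≡ᵇ 0) ∨ (y ≡ᵇ 0)) ∧ disjoint u v

+ᵛ-identityˡ : (v : Vec ℕ N) → 0ᵛ +ᵛ v ≡ v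
+ᵛ-identityˡ = VP.zipWith-identityˡ NP.+-identityˡ

+ᵛ-identityʳ : (v : Vec ℕ N) → v +ᵛ 0ᵛ ≡ v
+ᵛ-identityʳ = VP.zipWith-identityʳ NP.+-identityʳ

+ᵛ-exchange : (u v w : Vec ℕ N) → u +ᵛ (v +ᵛ w) ≡ (v +ᵛ u) +ᵛ w
+ᵛ-exchange u v w = trans (sym (VP.zipWith-assoc NP.+-assoc u v w))
                          (cong (_+ᵛ w) (VP.zipWith-comm NP.+-comm u v))

lookup-+ᵛ : (u v : Vec ℕ N) (i : Fin N) → lookup (u +ᵛ v) i ≡ lookup u i + lookup v i
lookup-+ᵛ u v i = VP.lookup-zipWith _+_ i u v

lookup-0ᵛ : (i : Fin N) → lookup (0ᵛ {N}) i ≡ 0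
lookup-0ᵛ i = VP.lookup-replicate i 0

lookup-𝟏 : (c i : Fin N) → lookup (𝟏 c) i ≡ when (c ==F i) 1
lookup-𝟏 Fin.zero    Fin.zero    = refl
lookup-𝟏 Fin.zero    (Fin.suc i) = lookup-0ᵛ i
lookup-𝟏 (Fin.suc c) Fin.zero    = refl
lookup-𝟏 (Fin.suc c) (Fin.suc i) = trans (lookup-𝟏 c i) (cong (λ b → when b 1) (sym (==F-suc c i)))

degree-𝟏+ᵛ : (c : Fin N) (v : Vec ℕ N) → degree (𝟏 c +ᵛ v) ≡ suc (degree v)
degree-𝟏+ᵛ Fin.zero    (x ∷ v) = cong (λ u → suc (x + degree u)) (+ᵛ-identityˡ v)
degree-𝟏+ᵛ (Fin.suc c) (x ∷ v) = trans (cong (x +_) (degree-𝟏+ᵛ c v)) (NP.+-suc x _)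

is01⇒lookup≤1 : (v : Vec ℕ N) (i : Fin N) → is01 v ≡ true → (lookup v i ≤ᵇ 1) ≡ true
is01⇒lookup≤1 (x ∷ v) Fin.zero    p with x ≤ᵇ 1
... | true = refl
is01⇒lookup≤1 (x ∷ v) (Fin.suc i) p with x ≤ᵇ 1
... | true = is01⇒lookup≤1 v i p

≤ᵛ∧==ᵛ∸≡+ᵛ==ᵛ : (β γ α : Vec ℕ N) → (β ≤ᵛ α) ∧ (γ ==ᵛ zipWith _∸_ α β) ≡ (β +ᵛ γ ==ᵛ α)
≤ᵛ∧==ᵛ∸≡+ᵛ==ᵛ []      []      []      = refl
≤ᵛ∧==ᵛ∸≡+ᵛ==ᵛ (b ∷ β) (g ∷ γ) (a ∷ α) =
  trans (∧-interchange (b ≤ᵇ a) (β ≤ᵛ α) (g ≡ᵇ a ∸ b) _)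
        (cong₂ _∧_ (scalar b a g) (≤ᵛ∧==ᵛ∸≡+ᵛ==ᵛ β γ α))
  where
  scalar : ∀ b a g → (b ≤ᵇ a) ∧ (g ≡ᵇ a ∸ b) ≡ (b + g ≡ᵇ a)
  scalar zero    a       g = refl
  scalar (suc b) zero    g = refl
  scalar (suc b) (suc a) g = trans (cong (_∧ (g ≡ᵇ a ∸ b)) (lt b a)) (scalar b a g)
    where
    lt : ∀ b a → (b <ᵇ suc a) ≡ (b ≤ᵇ a)
    lt zero    a = refl
    lt (suc b) a = refl

disjoint-0ᵛʳ : (v : Vec ℕ N) → disjoint v 0ᵛ ≡ true
disjoint-0ᵛʳ []      = refl
disjoint-0ᵛʳ (x ∷ v) = trans (cong (_∧ disjoint v 0ᵛ) (BP.∨-zeroʳ (x ≡ᵇ 0))) (disjoint-0ᵛʳ v)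

disjoint-0ᵛˡ : (v : Vec ℕ N) → disjoint 0ᵛ v ≡ true
disjoint-0ᵛˡ []      = refl
disjoint-0ᵛˡ (x ∷ v) = disjoint-0ᵛˡ v

disjoint-+𝟏ʳ : (u v : Vec ℕ N) (c : Fin N) → disjoint u (𝟏 c +ᵛ v) ≡ (lookup u c ≡ᵇ 0) ∧ disjoint u v
disjoint-+𝟏ʳ (x ∷ u) (y ∷ v) Fin.zero rewrite +ᵛ-identityˡ v with x ≡ᵇ 0
... | true  = refl
... | false = refl
disjoint-+𝟏ʳ (x ∷ u) (y ∷ v) (Fin.suc c) rewrite disjoint-+𝟏ʳ u v c with (x ≡ᵇ 0) ∨ (y ≡ᵇ 0) | lookup u c ≡ᵇ 0
... | true  | _     = refl
... | false | true  = refl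
... | false | false = refl

disjoint-+𝟏ˡ : (u v : Vec ℕ N) (c : Fin N) → disjoint (𝟏 c +ᵛ u) v ≡ (lookup v c ≡ᵇ 0) ∧ disjoint u v
disjoint-+𝟏ˡ (x ∷ u) (y ∷ v) Fin.zero rewrite +ᵛ-identityˡ u with y ≡ᵇ 0
... | true  = cong (_∧ disjoint u v) (sym (BP.∨-zeroʳ (x ≡ᵇ 0)))
... | false = refl
disjoint-+𝟏ˡ (x ∷ u) (y ∷ v) (Fin.suc c) rewrite disjoint-+𝟏ˡ u v c with (x ≡ᵇ 0) ∨ (y ≡ᵇ 0) | lookup v c ≡ᵇ 0
... | true  | _     = refl
... | false | true  = refl
... | false | false = refl

∑Subsets-cong01 : ∀ N {f g : Vec ℕ N → ℕ} → (∀ S → is01 S ≡ true → f S ≡ g S) → ∑Subsets N f ≡ ∑Subsets N g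
∑Subsets-cong01 zero    f≗g = f≗g [] refl
∑Subsets-cong01 (suc N) f≗g = cong₂ _+_ (∑Subsets-cong01 N (λ S p → f≗g (0 ∷ S) p))
                                        (∑Subsets-cong01 N (λ S p → f≗g (1 ∷ S) p))

∑Subsets-degree≡0 : ∀ N (f : Vec ℕ N → ℕ) → ∑Subsets N (λ S → when (degree S ≡ᵇ 0) (f S)) ≡ f 0ᵛ
∑Subsets-degree≡0 zero    f = refl
∑Subsets-degree≡0 (suc N) f = begin
  ∑Subsets N (λ S → when (degree S ≡ᵇ 0) (f (0 ∷ S))) + ∑Subsets N (λ _ → 0)
    ≡⟨ cong₂ _+_ (∑Subsets-degree≡0 N (λ S → f (0 ∷ S))) (∑-0 (∑Subsets-isSummation N)) ⟩
  f 0ᵛ + 0 ≡⟨ NP.+-identityʳ _ ⟩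
  f 0ᵛ ∎

∑Subsets-==ᵛ : ∀ {N} (α : Vec ℕ N) (p : Vec ℕ N → Bool) →
  ∑Subsets N (λ S → when (p S) (when (S ==ᵛ α) 1)) ≡ when (is01 α) (when (p α) 1)
∑Subsets-==ᵛ []                  p = refl
∑Subsets-==ᵛ {suc N} (a ∷ α)     p = trans (cong₂ _+_ (at 0 a) (at 1 a)) (bit a)
  where
  S = ∑Subsets-isSummation N
  at : ∀ b a → ∑Subsets N (λ S → when (p (b ∷ S)) (when ((b ≡ᵇ a) ∧ (S ==ᵛ α)) 1))
             ≡ when (b ≡ᵇ a) (when (is01 α) (when (p (b ∷ α)) 1))
  at b a with b ≡ᵇ a
  ... | true  = ∑Subsets-==ᵛ α (λ S → p (b ∷ S))
  ... | false = trans (∑-cong S (λ T → when-zero (p (b ∷ T)))) (∑-0 S)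
  bit : ∀ a → when (0 ≡ᵇ a) (when (is01 α) (when (p (0 ∷ α)) 1)) + when (1 ≡ᵇ a) (when (is01 α) (when (p (1 ∷ α)) 1))
            ≡ when (is01 (a ∷ α)) (when (p (a ∷ α)) 1)
  bit zero          = NP.+-identityʳ _
  bit (suc zero)    = refl
  bit (suc (suc a)) = refl

∑Subsets-shift : ∀ {N} (c : Fin N) (h : Vec ℕ N → ℕ) →
  ∑Subsets N (λ T → when (lookup T c ≡ᵇ 0) (h (𝟏 c +ᵛ T))) ≡ ∑Subsets N (λ S → when (lookup S c ≡ᵇ 1) (h S))
∑Subsets-shift {suc N} Fin.zero    h =
  trans (NP.+-comm (∑Subsets N (λ T → h (1 ∷ (0ᵛ +ᵛ T)))) _) (cong (∑Subsets N (λ _ → 0) +_)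
    (∑-cong (∑Subsets-isSummation N) (λ T → cong (λ v → h (1 ∷ v)) (+ᵛ-identityˡ T))))
∑Subsets-shift {suc N} (Fin.suc c) h =
  cong₂ _+_ (∑Subsets-shift c (λ v → h (0 ∷ v))) (∑Subsets-shift c (λ v → h (1 ∷ v)))

∑List-below : ∀ {N} (α : Vec ℕ N) (h : Vec ℕ N → ℕ) →
  ∑List (below α) (λ β → when (is01 β) (h β)) ≡ ∑Subsets N (λ β → when (β ≤ᵛ α) (h β))
∑List-below []      h = NP.+-identityʳ (h [])
∑List-below {suc N} (a ∷ α) h = begin
  ∑List (below (a ∷ α)) (λ β → when (is01 β) (h β))
    ≡⟨ ∑List-concatMap (λ b → map (b ∷_) (below α)) (upTo (suc a)) _ ⟩
  ∑List (upTo (suc a)) (λ b → ∑List (map (b ∷_) (below α)) (λ β → when (is01 β) (h β)))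
    ≡⟨ ∑-cong (∑List-isSummation (upTo (suc a))) restricted ⟩
  ∑List (upTo (suc a)) (λ b → when (b ≤ᵇ 1) (Q b))
    ≡⟨ digits a ⟩
  Q 0 + when (1 ≤ᵇ a) (Q 1)
    ≡⟨ cong (Q 0 +_) (trans (sym (∑-when Sub (1 ≤ᵇ a) _))
                           (∑-cong Sub (λ β → sym (when-∧ (1 ≤ᵇ a) (β ≤ᵛ α) (h (1 ∷ β)))))) ⟩
  ∑Subsets (suc N) (λ β → when (β ≤ᵛ (a ∷ α)) (h β)) ∎
  where
  Sub = ∑Subsets-isSummation N
  Q : ℕ → ℕ
  Q b = ∑Subsets N (λ β → when (β ≤ᵛ α) (h (b ∷ β)))
  restricted : ∀ b → ∑List (map (b ∷_) (below α)) (λ β → when (is01 β) (h β)) ≡ when (b ≤ᵇ 1) (Q b)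
  restricted b = begin
    ∑List (map (b ∷_) (below α)) (λ β → when (is01 β) (h β))
      ≡⟨ ∑List-map (b ∷_) (below α) _ ⟩
    ∑List (below α) (λ β → when ((b ≤ᵇ 1) ∧ is01 β) (h (b ∷ β)))
      ≡⟨ ∑-cong (∑List-isSummation (below α)) (λ β → when-∧ (b ≤ᵇ 1) (is01 β) (h (b ∷ β))) ⟩
    ∑List (below α) (λ β → when (b ≤ᵇ 1) (when (is01 β) (h (b ∷ β))))
      ≡⟨ ∑-when (∑List-isSummation (below α)) (b ≤ᵇ 1) _ ⟩
    when (b ≤ᵇ 1) (∑List (below α) (λ β → when (is01 β) (h (b ∷ β))))
      ≡⟨ cong (when (b ≤ᵇ 1)) (∑List-below α (λ β → h (b ∷ β))) ⟩
    when (b ≤ᵇ 1) (Q b) ∎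
  beyondOne : ∀ n (g : ℕ → ℕ) → ∑List (List.applyUpTo (λ i → suc (suc (g i))) n) (λ b → when (b ≤ᵇ 1) (Q b)) ≡ 0
  beyondOne zero    g = refl
  beyondOne (suc n) g = beyondOne n (λ i → g (suc i))
  digits : ∀ a → ∑List (upTo (suc a)) (λ b → when (b ≤ᵇ 1) (Q b)) ≡ Q 0 + when (1 ≤ᵇ a) (Q 1)
  digits zero    = refl
  digits (suc a) = cong (λ z → Q 0 + z) (trans (cong (Q 1 +_) (beyondOne a (λ i → i))) (NP.+-identityʳ (Q 1)))

-- Colourings of paths

monomial : Vec (Fin N) k → Vec ℕ N
monomial []      = 0ᵛ
monomial (c ∷ κ) = 𝟏 c +ᵛ monomial κ

startsAwayFrom : Fin N → Vec (Fin N) k → Bool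
startsAwayFrom c []      = true
startsAwayFrom c (d ∷ _) = not (c ==F d)

startsOutside : Vec ℕ N → Vec (Fin N) k → Bool
startsOutside S []      = true
startsOutside S (c ∷ _) = lookup S c ≡ᵇ 0

isPathColouring : Vec (Fin N) k → Bool
isPathColouring []      = true
isPathColouring (c ∷ κ) = startsAwayFrom c κ ∧ isPathColouring κ

∑Fin-ones : (S : Vec ℕ N) → is01 S ≡ true → ∑Fin N (λ c → when (lookup S c ≡ᵇ 1) 1) ≡ degree S
∑Fin-ones []      _ = refl
∑Fin-ones (x ∷ S) p with x ≤ᵇ 1 in x≤1
... | true = cong₂ _+_ (bit x x≤1) (∑Fin-ones S p)
  where
  bit : ∀ x → (x ≤ᵇ 1) ≡ true → when (x ≡ᵇ 1) 1 ≡ x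
  bit zero          _ = refl
  bit (suc zero)    _ = refl
  bit (suc (suc x)) ()

∑Fin-count-except : ∀ n (g : Fin n → Bool) (d : Fin n) →
  ∑Fin n (λ c → when (g c) (when (not (c ==F d)) 1)) + when (g d) 1 ≡ ∑Fin n (λ c → when (g c) 1)
∑Fin-count-except (suc n) g Fin.zero = begin
  (when (g Fin.zero) 0 + rest) + when (g Fin.zero) 1
    ≡⟨ cong (λ z → (z + rest) + when (g Fin.zero) 1) (when-zero (g Fin.zero)) ⟩
  rest + when (g Fin.zero) 1
    ≡⟨ NP.+-comm rest _ ⟩
  when (g Fin.zero) 1 + rest ∎
  where rest = ∑Fin n (λ c → when (g (Fin.suc c)) 1)
∑Fin-count-except (suc n) g (Fin.suc d) = begin
  (g₀ + ∑Fin n (λ c → when (g (Fin.suc c)) (when (not (Fin.suc c ==F Fin.suc d)) 1))) + when (g (Fin.suc d)) 1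
    ≡⟨ NP.+-assoc g₀ _ _ ⟩
  g₀ + (∑Fin n (λ c → when (g (Fin.suc c)) (when (not (Fin.suc c ==F Fin.suc d)) 1)) + when (g (Fin.suc d)) 1)
    ≡⟨ cong (λ z → g₀ + (z + when (g (Fin.suc d)) 1))
            (∑-cong (∑Fin-isSummation n) (λ c → cong (λ b → when (g (Fin.suc c)) (when (not b) 1)) (==F-suc c d))) ⟩
  g₀ + (∑Fin n (λ c → when (g (Fin.suc c)) (when (not (c ==F d)) 1)) + when (g (Fin.suc d)) 1)
    ≡⟨ cong (g₀ +_) (∑Fin-count-except n (λ c → g (Fin.suc c)) d) ⟩
  g₀ + ∑Fin n (λ c → when (g (Fin.suc c)) 1) ∎
  where g₀ = when (g Fin.zero) 1

∑Fin-count-startsAwayFrom : ∀ s (S : Vec ℕ N) (κ : Vec (Fin N) k) → is01 S ≡ true → degree S ≡ suc s →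
  ∑Fin N (λ c → when (lookup S c ≡ᵇ 1) (when (startsAwayFrom c κ) 1)) ≡ s + when (startsOutside S κ) 1
∑Fin-count-startsAwayFrom s S []      p |S| = trans (∑Fin-ones S p) (trans |S| (NP.+-comm 1 s))
∑Fin-count-startsAwayFrom {N} s S (d ∷ κ) p |S| = NP.+-cancelʳ-≡ _ _ _ (begin
  awayFrom-d + in-d  ≡⟨ ∑Fin-count-except N (λ c → lookup S c ≡ᵇ 1) d ⟩
  ∑Fin N (λ c → when (lookup S c ≡ᵇ 1) 1) ≡⟨ ∑Fin-ones S p ⟩
  degree S ≡⟨ |S| ⟩
  suc s ≡⟨ NP.+-comm 1 s ⟩
  s + 1 ≡⟨ cong (s +_) (sym (bit (lookup S d) (is01⇒lookup≤1 S d p))) ⟩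
  s + (in-d + out-d) ≡⟨ cong (s +_) (NP.+-comm in-d out-d) ⟩
  s + (out-d + in-d) ≡⟨ sym (NP.+-assoc s out-d in-d) ⟩
  (s + out-d) + in-d ∎)
  where
  awayFrom-d = ∑Fin N (λ c → when (lookup S c ≡ᵇ 1) (when (not (c ==F d)) 1))
  in-d  = when (lookup S d ≡ᵇ 1) 1
  out-d = when (lookup S d ≡ᵇ 0) 1
  bit : ∀ x → (x ≤ᵇ 1) ≡ true → when (x ≡ᵇ 1) 1 + when (x ≡ᵇ 0) 1 ≡ 1
  bit zero          _ = refl
  bit (suc zero)    _ = refl
  bit (suc (suc x)) ()

∑Fin-ones-outside : (S T : Vec ℕ N) → disjoint S T ≡ true →
  ∑Fin N (λ x → when (lookup T x ≡ᵇ 0) (when (lookup S x ≡ᵇ 1) 1)) ≡ ∑Fin N (λ x → when (lookup S x ≡ᵇ 1) 1)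
∑Fin-ones-outside []      []      _ = refl
∑Fin-ones-outside (s ∷ S) (t ∷ T) p with (s ≡ᵇ 0) ∨ (t ≡ᵇ 0) in s∨t
... | true = cong₂ _+_ (head s t s∨t) (∑Fin-ones-outside S T p)
  where
  head : ∀ s t → ((s ≡ᵇ 0) ∨ (t ≡ᵇ 0)) ≡ true → when (t ≡ᵇ 0) (when (s ≡ᵇ 1) 1) ≡ when (s ≡ᵇ 1) 1
  head s    zero    _ = refl
  head zero (suc t) _ = refl

sumℤ-upTo-suc : ∀ (g : ℕ → ℤ) n → sumℤ (map g (upTo (suc n))) ≡ sumℤ (map g (upTo n)) ℤ.+ g n
sumℤ-upTo-suc g n = go g (λ b → b) n
  where
  go : ∀ (g : ℕ → ℤ) (f : ℕ → ℕ) n →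
    sumℤ (map g (List.applyUpTo f (suc n))) ≡ sumℤ (map g (List.applyUpTo f n)) ℤ.+ g (f n)
  go g f zero    = trans (ZP.+-identityʳ (g (f 0))) (sym (ZP.+-identityˡ (g (f 0))))
  go g f (suc n) = trans (cong (λ z → g (f 0) ℤ.+ z) (go g (λ b → f (suc b)) n)) (sym (ZP.+-assoc (g (f 0)) _ _))

∸≡suc∸suc : ∀ {n a} → a < n → n ∸ a ≡ suc (n ∸ suc a)
∸≡suc∸suc {suc n} (s≤s a≤n) = NP.+-∸-assoc 1 a≤n

module PathCount {N : ℕ} (w : Vec ℕ N → ℕ) where

  ePath : ℕ → ℕ → ℕ
  ePath l k = ∑Subsets N (λ S → when (degree S ≡ᵇ l)
    (∑Colourings N k (λ κ → when (isPathColouring κ) (w (S +ᵛ monomial κ)))))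

  ePathOutside : ℕ → ℕ → ℕ
  ePathOutside s k = ∑Subsets N (λ S → when (degree S ≡ᵇ s)
    (∑Colourings N k (λ κ → when (isPathColouring κ ∧ startsOutside S κ) (w (S +ᵛ monomial κ)))))

  ePathOutside-zero : ∀ k → ePathOutside 0 k ≡ ePath 0 k
  ePathOutside-zero k = trans (∑Subsets-degree≡0 N _)
    (trans (∑-cong (∑Colourings-isSummation N k) outside-0ᵛ) (sym (∑Subsets-degree≡0 N _)))
    where
    outside-0ᵛ : ∀ (κ : Vec (Fin N) k) → when (isPathColouring κ ∧ startsOutside 0ᵛ κ) (w (0ᵛ +ᵛ monomial κ))
                                       ≡ when (isPathColouring κ) (w (0ᵛ +ᵛ monomial κ))
    outside-0ᵛ []      = refl
    outside-0ᵛ (c ∷ κ) rewrite lookup-0ᵛ c | BP.∧-identityʳ (isPathColouring (c ∷ κ)) = refl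

  marked : ℕ → ℕ → Fin N → Vec ℕ N → ℕ
  marked s k c S = when (degree S ≡ᵇ suc s)
    (∑Colourings N k (λ κ → when (startsAwayFrom c κ ∧ isPathColouring κ) (w (S +ᵛ monomial κ))))

  -- each κ is counted once for every c ∈ S other than its first colour
  ∑Fin-marks : ∀ s k (S : Vec ℕ N) → is01 S ≡ true → degree S ≡ suc s →
    ∑Fin N (λ c → when (lookup S c ≡ᵇ 1)
      (∑Colourings N k (λ κ → when (startsAwayFrom c κ ∧ isPathColouring κ) (w (S +ᵛ monomial κ)))))
    ≡ s * ∑Colourings N k (λ κ → when (isPathColouring κ) (w (S +ᵛ monomial κ)))
      + ∑Colourings N k (λ κ → when (isPathColouring κ ∧ startsOutside S κ) (w (S +ᵛ monomial κ)))
  ∑Fin-marks s k S p |S| = begin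
    ∑Fin N (λ c → when (lookup S c ≡ᵇ 1) (∑Colourings N k (λ κ → when (startsAwayFrom c κ ∧ isPathColouring κ) (W κ))))
      ≡⟨ ∑-cong Fin' (λ c → sym (∑-when Col (lookup S c ≡ᵇ 1) _)) ⟩
    ∑Fin N (λ c → ∑Colourings N k (λ κ → when (lookup S c ≡ᵇ 1) (when (startsAwayFrom c κ ∧ isPathColouring κ) (W κ))))
      ≡⟨ ∑Fin-interchange Col N _ ⟩
    ∑Colourings N k (λ κ → ∑Fin N (λ c → when (lookup S c ≡ᵇ 1) (when (startsAwayFrom c κ ∧ isPathColouring κ) (W κ))))
      ≡⟨ ∑-cong Col perColouring ⟩
    ∑Colourings N k (λ κ → s * when (isPathColouring κ) (W κ) + when (isPathColouring κ ∧ startsOutside S κ) (W κ))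
      ≡⟨ ∑-+ Col _ _ ⟩
    ∑Colourings N k (λ κ → s * when (isPathColouring κ) (W κ)) + outside
      ≡⟨ cong (_+ outside) (∑-*ˡ Col s _) ⟩
    s * ∑Colourings N k (λ κ → when (isPathColouring κ) (W κ)) + outside ∎
    where
    Fin' = ∑Fin-isSummation N
    Col  = ∑Colourings-isSummation N k
    W : Vec (Fin N) k → ℕ
    W κ = w (S +ᵛ monomial κ)
    outside = ∑Colourings N k (λ κ → when (isPathColouring κ ∧ startsOutside S κ) (W κ))
    perColouring : ∀ κ →
      ∑Fin N (λ c → when (lookup S c ≡ᵇ 1) (when (startsAwayFrom c κ ∧ isPathColouring κ) (W κ)))
      ≡ s * when (isPathColouring κ) (W κ) + when (isPathColouring κ ∧ startsOutside S κ) (W κ)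
    perColouring κ = begin
      ∑Fin N (λ c → when (lookup S c ≡ᵇ 1) (when (startsAwayFrom c κ ∧ isPathColouring κ) (W κ)))
        ≡⟨ ∑-cong Fin' (λ c → trans (cong (when (lookup S c ≡ᵇ 1)) (when-∧ (startsAwayFrom c κ) _ _))
                                    (when-when≡* (lookup S c ≡ᵇ 1) (startsAwayFrom c κ) Wκ)) ⟩
      ∑Fin N (λ c → Wκ * when (lookup S c ≡ᵇ 1) (when (startsAwayFrom c κ) 1))
        ≡⟨ ∑-*ˡ Fin' Wκ _ ⟩
      Wκ * ∑Fin N (λ c → when (lookup S c ≡ᵇ 1) (when (startsAwayFrom c κ) 1))
        ≡⟨ cong (Wκ *_) (∑Fin-count-startsAwayFrom s S κ p |S|) ⟩
      Wκ * (s + when (startsOutside S κ) 1)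
        ≡⟨ NP.*-distribˡ-+ Wκ s _ ⟩
      Wκ * s + Wκ * when (startsOutside S κ) 1
        ≡⟨ cong₂ _+_ (NP.*-comm Wκ s) (sym (trans (when-∧ (isPathColouring κ) (startsOutside S κ) (W κ))
          (trans (when-comm (isPathColouring κ) (startsOutside S κ) (W κ)) (when≡*indicator (startsOutside S κ) Wκ)))) ⟩
      s * Wκ + when (isPathColouring κ ∧ startsOutside S κ) (W κ) ∎
      where Wκ = when (isPathColouring κ) (W κ)

  ePathOutside-suc : ∀ s k → ePathOutside s (suc k) ≡ s * ePath (suc s) k + ePathOutside (suc s) k
  ePathOutside-suc s k = begin
    ePathOutside s (suc k)
      ≡⟨ ∑-cong Sub (λ T → trans (sym (∑-when Fin' (degree T ≡ᵇ s) _)) (∑-cong Fin' (headIntoSubset T))) ⟩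
    ∑Subsets N (λ T → ∑Fin N (λ c → when (lookup T c ≡ᵇ 0) (marked s k c (𝟏 c +ᵛ T))))
      ≡⟨ sym (∑Fin-interchange Sub N _) ⟩
    ∑Fin N (λ c → ∑Subsets N (λ T → when (lookup T c ≡ᵇ 0) (marked s k c (𝟏 c +ᵛ T))))
      ≡⟨ ∑-cong Fin' (λ c → ∑Subsets-shift c (marked s k c)) ⟩
    ∑Fin N (λ c → ∑Subsets N (λ S → when (lookup S c ≡ᵇ 1) (marked s k c S)))
      ≡⟨ ∑Fin-interchange Sub N _ ⟩
    ∑Subsets N (λ S → ∑Fin N (λ c → when (lookup S c ≡ᵇ 1) (marked s k c S)))
      ≡⟨ ∑Subsets-cong01 N forgetMark ⟩
    ∑Subsets N (λ S → s * all S + outside S)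
      ≡⟨ ∑-+ Sub _ _ ⟩
    ∑Subsets N (λ S → s * all S) + ePathOutside (suc s) k
      ≡⟨ cong (_+ ePathOutside (suc s) k) (∑-*ˡ Sub s all) ⟩
    s * ePath (suc s) k + ePathOutside (suc s) k ∎
    where
    Sub  = ∑Subsets-isSummation N
    Fin' = ∑Fin-isSummation N
    Col  = ∑Colourings-isSummation N k
    all outside : Vec ℕ N → ℕ
    all S     = when (degree S ≡ᵇ suc s) (∑Colourings N k (λ κ → when (isPathColouring κ) (w (S +ᵛ monomial κ))))
    outside S = when (degree S ≡ᵇ suc s)
      (∑Colourings N k (λ κ → when (isPathColouring κ ∧ startsOutside S κ) (w (S +ᵛ monomial κ))))

    headIntoSubset : ∀ T c →
      when (degree T ≡ᵇ s) (∑Colourings N k (λ κ →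
        when ((startsAwayFrom c κ ∧ isPathColouring κ) ∧ (lookup T c ≡ᵇ 0)) (w (T +ᵛ (𝟏 c +ᵛ monomial κ)))))
      ≡ when (lookup T c ≡ᵇ 0) (marked s k c (𝟏 c +ᵛ T))
    headIntoSubset T c = begin
      when (degree T ≡ᵇ s) (∑Colourings N k (λ κ → when (away κ ∧ free) (w (T +ᵛ (𝟏 c +ᵛ monomial κ)))))
        ≡⟨ cong (when (degree T ≡ᵇ s)) (∑-cong Col (λ κ →
             trans (trans (when-∧ (away κ) free _) (when-comm (away κ) free _))
                   (cong (λ v → when free (when (away κ) (w v))) (+ᵛ-exchange T (𝟏 c) (monomial κ))))) ⟩
      when (degree T ≡ᵇ s) (∑Colourings N k (λ κ → when free (moved κ)))
        ≡⟨ cong (when (degree T ≡ᵇ s)) (∑-when Col free moved) ⟩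
      when (degree T ≡ᵇ s) (when free (∑Colourings N k moved))
        ≡⟨ when-comm (degree T ≡ᵇ s) free _ ⟩
      when free (when (degree T ≡ᵇ s) (∑Colourings N k moved))
        ≡⟨ cong (λ d → when free (when (d ≡ᵇ suc s) (∑Colourings N k moved))) (sym (degree-𝟏+ᵛ c T)) ⟩
      when free (marked s k c (𝟏 c +ᵛ T)) ∎
      where
      free = lookup T c ≡ᵇ 0
      away : Vec (Fin N) k → Bool
      away κ = startsAwayFrom c κ ∧ isPathColouring κ
      moved : Vec (Fin N) k → ℕ
      moved κ = when (away κ) (w ((𝟏 c +ᵛ T) +ᵛ monomial κ))

    forgetMark : ∀ S → is01 S ≡ true → ∑Fin N (λ c → when (lookup S c ≡ᵇ 1) (marked s k c S)) ≡ s * all S + outside S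
    forgetMark S p = begin
      ∑Fin N (λ c → when (lookup S c ≡ᵇ 1) (when |S|≡1+s (away c)))
        ≡⟨ ∑-cong Fin' (λ c → when-comm (lookup S c ≡ᵇ 1) |S|≡1+s (away c)) ⟩
      ∑Fin N (λ c → when |S|≡1+s (when (lookup S c ≡ᵇ 1) (away c)))
        ≡⟨ ∑-when Fin' |S|≡1+s _ ⟩
      when |S|≡1+s (∑Fin N (λ c → when (lookup S c ≡ᵇ 1) (away c)))
        ≡⟨ when-cong |S|≡1+s (λ eq → ∑Fin-marks s k S p (≡ᵇ-true⇒≡ eq)) ⟩
      when |S|≡1+s (s * _ + _)
        ≡⟨ when-+ |S|≡1+s _ _ ⟩
      when |S|≡1+s (s * _) + outside S
        ≡⟨ cong (_+ outside S) (when-*ˡ |S|≡1+s s _) ⟩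
      s * all S + outside S ∎
      where
      |S|≡1+s = degree S ≡ᵇ suc s
      away : Fin N → ℕ
      away c = ∑Colourings N k (λ κ → when (startsAwayFrom c κ ∧ isPathColouring κ) (w (S +ᵛ monomial κ)))

  eTerm : ℕ → ℕ → ℤ
  eTerm n l = (1ℤ ℤ.- pos l) ℤ.* pos (ePath l (n ∸ l))

  ∑eTerm≡ePathOutside : ∀ n a → a ≤ n → sumℤ (map (eTerm n) (upTo (suc a))) ≡ pos (ePathOutside a (n ∸ a))
  ∑eTerm≡ePathOutside n zero    _   = trans (ZP.+-identityʳ _) (trans (ZP.*-identityˡ _) (cong pos (sym (ePathOutside-zero n))))
  ∑eTerm≡ePathOutside n (suc a) a<n = begin
    sumℤ (map (eTerm n) (upTo (suc (suc a))))
      ≡⟨ sumℤ-upTo-suc (eTerm n) (suc a) ⟩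
    sumℤ (map (eTerm n) (upTo (suc a))) ℤ.+ eTerm n (suc a)
      ≡⟨ cong (ℤ._+ eTerm n (suc a)) (∑eTerm≡ePathOutside n a (NP.<⇒≤ a<n)) ⟩
    pos (ePathOutside a (n ∸ a)) ℤ.+ eTerm n (suc a)
      ≡⟨ cong (λ j → pos (ePathOutside a j) ℤ.+ eTerm n (suc a)) (∸≡suc∸suc a<n) ⟩
    pos (ePathOutside a (suc len)) ℤ.+ eTerm n (suc a)
      ≡⟨ cong (λ x → pos x ℤ.+ eTerm n (suc a)) (ePathOutside-suc a len) ⟩
    pos (a * E + H) ℤ.+ (1ℤ ℤ.- pos (suc a)) ℤ.* pos E
      ≡⟨ cong₂ (λ u v → u ℤ.+ (1ℤ ℤ.- v) ℤ.* pos E)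
               (trans (ZP.pos-+ (a * E) H) (cong (ℤ._+ pos H) (ZP.pos-* a E))) (ZP.pos-+ 1 a) ⟩
    (pos a ℤ.* pos E ℤ.+ pos H) ℤ.+ (1ℤ ℤ.- (1ℤ ℤ.+ pos a)) ℤ.* pos E
      ≡⟨ cancel (pos a) (pos E) (pos H) ⟩
    pos H ∎
    where
    len = n ∸ suc a
    E = ePath (suc a) len
    H = ePathOutside (suc a) len
    cancel : ∀ a e h → (a ℤ.* e ℤ.+ h) ℤ.+ (1ℤ ℤ.- (1ℤ ℤ.+ a)) ℤ.* e ≡ h
    cancel = solve-∀

-- Colourings of lollipops

module LollipopColourings {N : ℕ} (m : ℕ) where

  differsFromFirst : Fin N → (b : ℕ) → Vec (Fin N) (b + m) → Bool
  differsFromFirst x zero    κ       = true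
  differsFromFirst x (suc b) (y ∷ κ) = not (x ==F y) ∧ differsFromFirst x b κ

  firstOutside : Vec ℕ N → (b : ℕ) → Vec (Fin N) (b + m) → Bool
  firstOutside T zero    κ       = true
  firstOutside T (suc b) (y ∷ κ) = (lookup T y ≡ᵇ 0) ∧ firstOutside T b κ

  -- colourings of K_{1+a}^m; the first 1+a entries colour the clique, the last of them its junction with the path
  isLollipopColouring : (a : ℕ) → Vec (Fin N) (suc a + m) → Bool
  isLollipopColouring zero    ρ       = isPathColouring ρ
  isLollipopColouring (suc a) (x ∷ κ) = differsFromFirst x (suc a) κ ∧ isLollipopColouring a κ

  firstOutside-0ᵛ : ∀ b κ → firstOutside 0ᵛ b κ ≡ true
  firstOutside-0ᵛ zero    κ       = refl
  firstOutside-0ᵛ (suc b) (y ∷ κ) rewrite lookup-0ᵛ {N} y = firstOutside-0ᵛ b κ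

  firstOutside-𝟏+ᵛ : ∀ x T b κ → firstOutside (𝟏 x +ᵛ T) b κ ≡ differsFromFirst x b κ ∧ firstOutside T b κ
  firstOutside-𝟏+ᵛ x T zero    κ       = refl
  firstOutside-𝟏+ᵛ x T (suc b) (y ∷ κ) = begin
    (lookup (𝟏 x +ᵛ T) y ≡ᵇ 0) ∧ firstOutside (𝟏 x +ᵛ T) b κ
      ≡⟨ cong₂ _∧_ (cong (_≡ᵇ 0) (trans (lookup-+ᵛ (𝟏 x) T y) (cong (_+ lookup T y) (lookup-𝟏 x y))))
                   (firstOutside-𝟏+ᵛ x T b κ) ⟩
    (when (x ==F y) 1 + lookup T y ≡ᵇ 0) ∧ (differsFromFirst x b κ ∧ firstOutside T b κ)
      ≡⟨ cong (_∧ _) (indicator+≡0 (x ==F y) (lookup T y)) ⟩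
    (not (x ==F y) ∧ (lookup T y ≡ᵇ 0)) ∧ (differsFromFirst x b κ ∧ firstOutside T b κ)
      ≡⟨ ∧-interchange (not (x ==F y)) _ _ _ ⟩
    (not (x ==F y) ∧ differsFromFirst x b κ) ∧ ((lookup T y ≡ᵇ 0) ∧ firstOutside T b κ) ∎
    where
    indicator+≡0 : ∀ c t → (when c 1 + t ≡ᵇ 0) ≡ not c ∧ (t ≡ᵇ 0)
    indicator+≡0 true  t = refl
    indicator+≡0 false t = refl

module LollipopCount {N : ℕ} (w : Vec ℕ N → ℕ) (m : ℕ) where
  open LollipopColourings {N} m
  open PathCount w

  lollipops : ℕ → Vec ℕ N → ℕ
  lollipops a T = ∑Colourings N (suc a + m) (λ κ →
    when (isLollipopColouring a κ ∧ firstOutside T (suc a) κ) (w (T +ᵛ monomial κ)))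

  subsetAndPath : ℕ → Vec ℕ N → Vec ℕ N → ℕ
  subsetAndPath a T S = when (degree S ≡ᵇ a) (when (disjoint S T) (lollipops 0 (S +ᵛ T)))

  lollipops-suc : ∀ a T → lollipops (suc a) T ≡ ∑Fin N (λ x → when (lookup T x ≡ᵇ 0) (lollipops a (𝟏 x +ᵛ T)))
  lollipops-suc a T = ∑-cong (∑Fin-isSummation N) (λ x →
    trans (∑-cong Col (firstIntoT x)) (∑-when Col (lookup T x ≡ᵇ 0) (λ κ →
      when (isLollipopColouring a κ ∧ firstOutside (𝟏 x +ᵛ T) (suc a) κ) (w ((𝟏 x +ᵛ T) +ᵛ monomial κ)))))
    where
    Col = ∑Colourings-isSummation N (suc a + m)
    shuffle : ∀ d l t f W → when ((d ∧ l) ∧ (t ∧ f)) W ≡ when t (when (l ∧ (d ∧ f)) W)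
    shuffle d l true  f W rewrite BP.∧-comm d l | BP.∧-assoc l d f = refl
    shuffle d l false f W rewrite BP.∧-zeroʳ (d ∧ l) = refl
    firstIntoT : ∀ x κ →
      when (isLollipopColouring (suc a) (x ∷ κ) ∧ firstOutside T (suc (suc a)) (x ∷ κ)) (w (T +ᵛ monomial (x ∷ κ)))
      ≡ when (lookup T x ≡ᵇ 0) (when (isLollipopColouring a κ ∧ firstOutside (𝟏 x +ᵛ T) (suc a) κ) (w ((𝟏 x +ᵛ T) +ᵛ monomial κ)))
    firstIntoT x κ =
      trans (shuffle (differsFromFirst x (suc a) κ) (isLollipopColouring a κ) (lookup T x ≡ᵇ 0) (firstOutside T (suc a) κ) _)
            (cong₂ (λ b v → when (lookup T x ≡ᵇ 0) (when (isLollipopColouring a κ ∧ b) (w v)))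
                   (sym (firstOutside-𝟏+ᵛ x T (suc a) κ)) (+ᵛ-exchange T (𝟏 x) (monomial κ)))

  subsetAndPath-𝟏+ᵛ : ∀ a T x → (lookup T x ≡ᵇ 0) ≡ true → ∀ S →
    subsetAndPath a (𝟏 x +ᵛ T) S ≡ when (lookup S x ≡ᵇ 0) (subsetAndPath (suc a) T (𝟏 x +ᵛ S))
  subsetAndPath-𝟏+ᵛ a T x Tx≡0 S
    rewrite disjoint-+𝟏ʳ S T x | disjoint-+𝟏ˡ S T x | Tx≡0 | degree-𝟏+ᵛ x S | +ᵛ-exchange S (𝟏 x) T
    with lookup S x ≡ᵇ 0
  ... | true  = refl
  ... | false = when-zero (degree S ≡ᵇ a)

  -- Peel off the first clique colour x and add it to T; each (1 + a)-set S disjoint from T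
  -- then arises from each of its 1 + a elements x.
  lollipops≡!*subsetsAndPaths : ∀ a T → lollipops a T ≡ a ! * ∑Subsets N (subsetAndPath a T)
  lollipops≡!*subsetsAndPaths zero T = sym (begin
    ∑Subsets N (subsetAndPath 0 T) + 0
      ≡⟨ NP.+-identityʳ _ ⟩
    ∑Subsets N (subsetAndPath 0 T)
      ≡⟨ ∑Subsets-degree≡0 N (λ S → when (disjoint S T) (lollipops 0 (S +ᵛ T))) ⟩
    when (disjoint 0ᵛ T) (lollipops 0 (0ᵛ +ᵛ T))
      ≡⟨ cong₂ (λ b v → when b (lollipops 0 v)) (disjoint-0ᵛˡ T) (+ᵛ-identityˡ T) ⟩
    lollipops 0 T ∎)
  lollipops≡!*subsetsAndPaths (suc a) T = begin
    lollipops (suc a) T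
      ≡⟨ lollipops-suc a T ⟩
    ∑Fin N (λ x → when (lookup T x ≡ᵇ 0) (lollipops a (𝟏 x +ᵛ T)))
      ≡⟨ ∑-cong Fin' (λ x → trans (cong (when (lookup T x ≡ᵇ 0)) (lollipops≡!*subsetsAndPaths a (𝟏 x +ᵛ T)))
                                  (when-*ˡ (lookup T x ≡ᵇ 0) (a !) _)) ⟩
    ∑Fin N (λ x → a ! * when (lookup T x ≡ᵇ 0) (∑Subsets N (subsetAndPath a (𝟏 x +ᵛ T))))
      ≡⟨ ∑-*ˡ Fin' (a !) _ ⟩
    a ! * ∑Fin N (λ x → when (lookup T x ≡ᵇ 0) (∑Subsets N (subsetAndPath a (𝟏 x +ᵛ T))))
      ≡⟨ cong (a ! *_) (∑-cong Fin' (λ x → trans (removeColour x) (sym (∑-when Sub (lookup T x ≡ᵇ 0) _)))) ⟩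
    a ! * ∑Fin N (λ x → ∑Subsets N (λ S → when (lookup T x ≡ᵇ 0) (when (lookup S x ≡ᵇ 1) (subsetAndPath (suc a) T S))))
      ≡⟨ cong (a ! *_) (∑Fin-interchange Sub N _) ⟩
    a ! * ∑Subsets N (λ S → ∑Fin N (λ x → when (lookup T x ≡ᵇ 0) (when (lookup S x ≡ᵇ 1) (subsetAndPath (suc a) T S))))
      ≡⟨ cong (a ! *_) (∑Subsets-cong01 N countRemovals) ⟩
    a ! * ∑Subsets N (λ S → suc a * subsetAndPath (suc a) T S)
      ≡⟨ cong (a ! *_) (∑-*ˡ Sub (suc a) _) ⟩
    a ! * (suc a * ∑Subsets N (subsetAndPath (suc a) T))
      ≡⟨ sym (NP.*-assoc (a !) (suc a) _) ⟩
    (a ! * suc a) * ∑Subsets N (subsetAndPath (suc a) T)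
      ≡⟨ cong (_* ∑Subsets N (subsetAndPath (suc a) T)) (NP.*-comm (a !) (suc a)) ⟩
    suc a ! * ∑Subsets N (subsetAndPath (suc a) T) ∎
    where
    Fin' = ∑Fin-isSummation N
    Sub  = ∑Subsets-isSummation N
    removeColour : ∀ x → when (lookup T x ≡ᵇ 0) (∑Subsets N (subsetAndPath a (𝟏 x +ᵛ T)))
                       ≡ when (lookup T x ≡ᵇ 0) (∑Subsets N (λ S → when (lookup S x ≡ᵇ 1) (subsetAndPath (suc a) T S)))
    removeColour x = when-cong (lookup T x ≡ᵇ 0) (λ Tx≡0 →
      trans (∑-cong Sub (subsetAndPath-𝟏+ᵛ a T x Tx≡0)) (∑Subsets-shift x (subsetAndPath (suc a) T)))
    countRemovals : ∀ S → is01 S ≡ true →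
      ∑Fin N (λ x → when (lookup T x ≡ᵇ 0) (when (lookup S x ≡ᵇ 1) (subsetAndPath (suc a) T S)))
      ≡ suc a * subsetAndPath (suc a) T S
    countRemovals S p = begin
      ∑Fin N (λ x → when (lookup T x ≡ᵇ 0) (when (lookup S x ≡ᵇ 1) Ψ))
        ≡⟨ ∑-cong Fin' (λ x → when-when≡* (lookup T x ≡ᵇ 0) (lookup S x ≡ᵇ 1) Ψ) ⟩
      ∑Fin N (λ x → Ψ * when (lookup T x ≡ᵇ 0) (when (lookup S x ≡ᵇ 1) 1))
        ≡⟨ ∑-*ˡ Fin' Ψ _ ⟩
      Ψ * ∑Fin N (λ x → when (lookup T x ≡ᵇ 0) (when (lookup S x ≡ᵇ 1) 1))
        ≡⟨ multiplicity (degree S ≡ᵇ suc a) refl (disjoint S T) refl ⟩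
      suc a * Ψ ∎
      where
      Ψ = subsetAndPath (suc a) T S
      multiplicity : ∀ d → (degree S ≡ᵇ suc a) ≡ d → ∀ j → disjoint S T ≡ j →
        when d (when j (lollipops 0 (S +ᵛ T))) * ∑Fin N (λ x → when (lookup T x ≡ᵇ 0) (when (lookup S x ≡ᵇ 1) 1))
        ≡ suc a * when d (when j (lollipops 0 (S +ᵛ T)))
      multiplicity false _    _     _ = sym (NP.*-zeroʳ (suc a))
      multiplicity true  _    false _ = sym (NP.*-zeroʳ (suc a))
      multiplicity true  |S|  true  disj =
        trans (cong (lollipops 0 (S +ᵛ T) *_)
                    (trans (∑Fin-ones-outside S T disj) (trans (∑Fin-ones S p) (≡ᵇ-true⇒≡ |S|))))
              (NP.*-comm (lollipops 0 (S +ᵛ T)) (suc a))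

  lollipopCount : ∀ a → ∑Colourings N (suc a + m) (λ κ → when (isLollipopColouring a κ) (w (monomial κ)))
                      ≡ a ! * ePathOutside a (suc m)
  lollipopCount a = begin
    ∑Colourings N (suc a + m) (λ κ → when (isLollipopColouring a κ) (w (monomial κ)))
      ≡⟨ ∑-cong (∑Colourings-isSummation N (suc a + m)) outside0ᵛ ⟩
    lollipops a 0ᵛ
      ≡⟨ lollipops≡!*subsetsAndPaths a 0ᵛ ⟩
    a ! * ∑Subsets N (subsetAndPath a 0ᵛ)
      ≡⟨ cong (a ! *_) (∑-cong (∑Subsets-isSummation N) (λ S → cong (when (degree S ≡ᵇ a))
            (trans (cong₂ (λ b v → when b (lollipops 0 v)) (disjoint-0ᵛʳ S) (+ᵛ-identityʳ S))
                   (∑-cong (∑Colourings-isSummation N (suc m)) (headOutside S))))) ⟩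
    a ! * ePathOutside a (suc m) ∎
    where
    outside0ᵛ : ∀ κ → when (isLollipopColouring a κ) (w (monomial κ))
                    ≡ when (isLollipopColouring a κ ∧ firstOutside 0ᵛ (suc a) κ) (w (0ᵛ +ᵛ monomial κ))
    outside0ᵛ κ rewrite firstOutside-0ᵛ (suc a) κ | +ᵛ-identityˡ (monomial κ)
                      | BP.∧-identityʳ (isLollipopColouring a κ) = refl
    headOutside : ∀ S (ρ : Vec (Fin N) (suc m)) →
      when (isPathColouring ρ ∧ firstOutside S 1 ρ) (w (S +ᵛ monomial ρ))
      ≡ when (isPathColouring ρ ∧ startsOutside S ρ) (w (S +ᵛ monomial ρ))
    headOutside S (y ∷ ρ) = cong (λ b → when (isPathColouring (y ∷ ρ) ∧ b) (w (S +ᵛ monomial (y ∷ ρ))))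
                                 (BP.∧-identityʳ (lookup S y ≡ᵇ 0))

-- Proper colourings of paths and lollipops

∀Fin : (n : ℕ) → (Fin n → Bool) → Bool
∀Fin zero    p = true
∀Fin (suc n) p = p Fin.zero ∧ ∀Fin n (λ i → p (Fin.suc i))

∀Fin-cong : ∀ n {p q : Fin n → Bool} → (∀ i → p i ≡ q i) → ∀Fin n p ≡ ∀Fin n q
∀Fin-cong zero    p≗q = refl
∀Fin-cong (suc n) p≗q = cong₂ _∧_ (p≗q Fin.zero) (∀Fin-cong n (λ i → p≗q (Fin.suc i)))

∀Fin-∧ : ∀ n (p q : Fin n → Bool) → ∀Fin n (λ i → p i ∧ q i) ≡ ∀Fin n p ∧ ∀Fin n q
∀Fin-∧ zero    p q = refl
∀Fin-∧ (suc n) p q = trans (cong ((p Fin.zero ∧ q Fin.zero) ∧_) (∀Fin-∧ n _ _))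
                           (∧-interchange (p Fin.zero) (q Fin.zero) _ _)

∀Fin-true : ∀ n → ∀Fin n (λ _ → true) ≡ true
∀Fin-true zero    = refl
∀Fin-true (suc n) = ∀Fin-true n

all-tabulate : ∀ {A : Set} n (p : A → Bool) (g : Fin n → A) → BL.all p (List.tabulate g) ≡ ∀Fin n (λ i → p (g i))
all-tabulate zero    p g = refl
all-tabulate (suc n) p g = cong (p (g Fin.zero) ∧_) (all-tabulate n p (λ i → g (Fin.suc i)))

isProper : (n : ℕ) → (Fin n → Fin n → Bool) → Vec (Fin N) n → Bool
isProper n adjacent κ = ∀Fin n (λ i → ∀Fin n (λ j → not (adjacent i j ∧ (lookup κ i ==F lookup κ j))))

proper≡isProper : (G : Graph) (κ : Vec (Fin N) (size G)) → proper G κ ≡ isProper (size G) (adj G) κ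
proper≡isProper G κ = trans (all-tabulate (size G) _ (λ i → i))
                            (∀Fin-cong (size G) (λ i → all-tabulate (size G) _ (λ j → j)))

isProper-cong : ∀ n {adj₁ adj₂ : Fin n → Fin n → Bool} → (∀ i j → adj₁ i j ≡ adj₂ i j) →
  (κ : Vec (Fin N) n) → isProper n adj₁ κ ≡ isProper n adj₂ κ
isProper-cong n eq κ = ∀Fin-cong n (λ i → ∀Fin-cong n (λ j → cong (λ b → not (b ∧ _)) (eq i j)))

isProper-∷ : ∀ n (adjacent : Fin (suc n) → Fin (suc n) → Bool) → adjacent Fin.zero Fin.zero ≡ false →
  (x : Fin N) (κ : Vec (Fin N) n) →
  isProper (suc n) adjacent (x ∷ κ)
  ≡ ∀Fin n (λ j → not (adjacent Fin.zero (Fin.suc j) ∧ (x ==F lookup κ j)))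
    ∧ (∀Fin n (λ i → not (adjacent (Fin.suc i) Fin.zero ∧ (x ==F lookup κ i)))
       ∧ isProper n (λ i j → adjacent (Fin.suc i) (Fin.suc j)) κ)
isProper-∷ n adjacent loopless x κ rewrite loopless = cong (∀Fin n row ∧_) (begin
  ∀Fin n (λ i → not (adjacent (Fin.suc i) Fin.zero ∧ (lookup κ i ==F x)) ∧ rest i)
    ≡⟨ ∀Fin-∧ n _ rest ⟩
  ∀Fin n (λ i → not (adjacent (Fin.suc i) Fin.zero ∧ (lookup κ i ==F x))) ∧ ∀Fin n rest
    ≡⟨ cong (_∧ ∀Fin n rest) (∀Fin-cong n (λ i →
         cong (λ b → not (adjacent (Fin.suc i) Fin.zero ∧ b)) (==F-sym (lookup κ i) x))) ⟩
  ∀Fin n (λ i → not (adjacent (Fin.suc i) Fin.zero ∧ (x ==F lookup κ i))) ∧ ∀Fin n rest ∎)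
  where
  row rest : Fin n → Bool
  row j  = not (adjacent Fin.zero (Fin.suc j) ∧ (x ==F lookup κ j))
  rest i = ∀Fin n (λ j → not (adjacent (Fin.suc i) (Fin.suc j) ∧ (lookup κ i ==F lookup κ j)))

a∧[a∧b]≡a∧b : ∀ a b → a ∧ (a ∧ b) ≡ a ∧ b
a∧[a∧b]≡a∧b true  b = refl
a∧[a∧b]≡a∧b false b = refl

isProper-path : ∀ k (κ : Vec (Fin N) k) → isProper k (adj (P k)) κ ≡ isPathColouring κ
isProper-path zero    []      = refl
isProper-path (suc k) (x ∷ κ) =
  trans (isProper-∷ k (adj (P (suc k))) refl x κ)
        (trans (cong₂ _∧_ (firstNeighbour κ (λ _ → refl))
                          (cong₂ _∧_ (firstNeighbour κ (λ j → BP.∨-identityʳ (toℕ j ≡ᵇ 0))) (isProper-path k κ)))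
               (a∧[a∧b]≡a∧b (startsAwayFrom x κ) (isPathColouring κ)))
  where
  firstNeighbour : ∀ {k} (κ : Vec (Fin _) k) {e : Fin k → Bool} → (∀ j → e j ≡ (toℕ j ≡ᵇ 0)) →
    ∀Fin k (λ j → not (e j ∧ (x ==F lookup κ j))) ≡ startsAwayFrom x κ
  firstNeighbour []              e≡ = refl
  firstNeighbour {suc k} (d ∷ κ) e≡ rewrite e≡ Fin.zero =
    trans (cong (not (x ==F d) ∧_) (trans (∀Fin-cong k (λ j → cong (λ b → not (b ∧ _)) (e≡ (Fin.suc j)))) (∀Fin-true k)))
          (BP.∧-identityʳ _)

module _ {N : ℕ} (m : ℕ) where
  open LollipopColourings {N} m

  private
    clique-adjacent : ∀ a (j : Fin (suc a + m)) →
      adj (Lollipop (suc (suc a)) m) Fin.zero (Fin.suc j) ≡ (toℕ j <ᵇ suc a)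
    clique-adjacent a j with toℕ j
    ... | zero  = refl
    ... | suc u with u <ᵇ a | a <ᵇ suc u
    ...   | true  | _     = refl
    ...   | false | true  = refl
    ...   | false | false = refl

    clique-adjacent′ : ∀ a (j : Fin (suc a + m)) →
      adj (Lollipop (suc (suc a)) m) (Fin.suc j) Fin.zero ≡ (toℕ j <ᵇ suc a)
    clique-adjacent′ a j with toℕ j
    ... | zero  = refl
    ... | suc u with u <ᵇ a | a <ᵇ suc u
    ...   | true  | _     = refl
    ...   | false | true  = refl
    ...   | false | false = refl

    lollipop₁-adj : ∀ (x y : Fin (suc m)) → adj (Lollipop 1 m) x y ≡ adj (P (suc m)) x y
    lollipop₁-adj x y = byValues (toℕ x) (toℕ y)
      where
      byValues : ∀ u v →
        not (u ≡ᵇ v) ∧ (((u <ᵇ 1) ∧ (v <ᵇ 1)) ∨ (((1 ≤ᵇ u) ∨ (1 ≤ᵇ v)) ∧ ((u ≡ᵇ suc v) ∨ (v ≡ᵇ suc u))))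
                       ≡ ((u ≡ᵇ suc v) ∨ (v ≡ᵇ suc u))
      byValues zero    zero    = refl
      byValues zero    (suc v) = refl
      byValues (suc u) zero    = refl
      byValues (suc u) (suc v) with u ≡ᵇ v in u≡v
      ... | true rewrite ≡ᵇ-true⇒≡ {u} {v} u≡v = sym (no-successor v)
        where
        no-successor : ∀ v → ((v ≡ᵇ suc v) ∨ (v ≡ᵇ suc v)) ≡ false
        no-successor zero    = refl
        no-successor (suc v) = no-successor v
      ... | false = refl

    firstClique : ∀ x b (κ : Vec (Fin N) (b + m)) →
      ∀Fin (b + m) (λ j → not ((toℕ j <ᵇ b) ∧ (x ==F lookup κ j))) ≡ differsFromFirst x b κ
    firstClique x zero    κ       = ∀Fin-true m
    firstClique x (suc b) (y ∷ κ) = cong (not (x ==F y) ∧_) (firstClique x b κ)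

  isProper-lollipop : ∀ a (κ : Vec (Fin N) (suc a + m)) →
    isProper (suc a + m) (adj (Lollipop (suc a) m)) κ ≡ isLollipopColouring a κ
  isProper-lollipop zero    ρ       = trans (isProper-cong (suc m) lollipop₁-adj ρ) (isProper-path (suc m) ρ)
  isProper-lollipop (suc a) (x ∷ κ) =
    trans (isProper-∷ (suc a + m) (adj (Lollipop (suc (suc a)) m)) refl x κ)
          (trans (cong₂ _∧_ (cliqueRow (clique-adjacent a))
                            (cong₂ _∧_ (cliqueRow (clique-adjacent′ a)) (isProper-lollipop a κ)))
                 (a∧[a∧b]≡a∧b (differsFromFirst x (suc a) κ) (isLollipopColouring a κ)))
    where
    cliqueRow : ∀ {e : Fin (suc a + m) → Bool} → (∀ j → e j ≡ (toℕ j <ᵇ suc a)) →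
      ∀Fin (suc a + m) (λ j → not (e j ∧ (x ==F lookup κ j))) ≡ differsFromFirst x (suc a) κ
    cliqueRow e≡ = trans (∀Fin-cong (suc a + m) (λ j → cong (λ b → not (b ∧ (x ==F lookup κ j))) (e≡ j)))
                         (firstClique x (suc a) κ)

-- Coefficients

sumℤ-pos : ∀ {A : Set} (xs : List A) (f : A → ℕ) → sumℤ (map (λ x → pos (f x)) xs) ≡ pos (∑List xs f)
sumℤ-pos []       f = refl
sumℤ-pos (x ∷ xs) f = trans (cong (λ z → pos (f x) ℤ.+ z) (sumℤ-pos xs f)) (sym (ZP.pos-+ (f x) _))

δ : Vec ℕ N → Vec ℕ N → ℕ
δ γ v = when (v ==ᵛ γ) 1

mult≡∑Fin : (κ : Vec (Fin N) k) (j : Fin N) → mult κ j ≡ ∑Fin k (λ i → when (lookup κ i ==F j) 1)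
mult≡∑Fin {k = k} κ j = ∑List-tabulate k (λ i → i) (λ i → when (lookup κ i ==F j) 1)

lookup-monomial : (κ : Vec (Fin N) k) (j : Fin N) → lookup (monomial κ) j ≡ mult κ j
lookup-monomial []      j = lookup-0ᵛ j
lookup-monomial (c ∷ κ) j = begin
  lookup (𝟏 c +ᵛ monomial κ) j              ≡⟨ lookup-+ᵛ (𝟏 c) (monomial κ) j ⟩
  lookup (𝟏 c) j + lookup (monomial κ) j    ≡⟨ cong₂ _+_ (lookup-𝟏 c j) (trans (lookup-monomial κ j) (mult≡∑Fin κ j)) ⟩
  when (c ==F j) 1 + ∑Fin _ (λ i → when (lookup κ i ==F j) 1) ≡⟨ sym (mult≡∑Fin (c ∷ κ) j) ⟩
  mult (c ∷ κ) j ∎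

hasMonomial≡==ᵛ : (κ : Vec (Fin N) k) (γ : Vec ℕ N) → hasMonomial κ γ ≡ (monomial κ ==ᵛ γ)
hasMonomial≡==ᵛ {N} κ γ =
  trans (all-tabulate N _ (λ i → i))
        (trans (∀Fin-cong N (λ j → cong (_≡ᵇ lookup γ j) (sym (lookup-monomial κ j)))) (pointwise (monomial κ) γ))
  where
  pointwise : ∀ {N} (v γ : Vec ℕ N) → ∀Fin N (λ j → lookup v j ≡ᵇ lookup γ j) ≡ (v ==ᵛ γ)
  pointwise []      []      = refl
  pointwise (x ∷ v) (y ∷ γ) = cong ((x ≡ᵇ y) ∧_) (pointwise v γ)

X-coefficient : (G : Graph) (γ : Vec ℕ N) →
  X G N γ ≡ pos (∑Colourings N (size G) (λ κ → when (isProper (size G) (adj G) κ) (δ γ (monomial κ))))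
X-coefficient {N} G γ = cong pos (trans (∑List-colourings N (size G) _)
  (∑-cong (∑Colourings-isSummation N (size G)) (λ κ → begin
    when (proper G κ ∧ hasMonomial κ γ) 1         ≡⟨ when-∧ (proper G κ) _ 1 ⟩
    when (proper G κ) (when (hasMonomial κ γ) 1)  ≡⟨ cong₂ (λ b c → when b (when c 1)) (proper≡isProper G κ) (hasMonomial≡==ᵛ κ γ) ⟩
    when (isProper (size G) (adj G) κ) (δ γ (monomial κ)) ∎)))

module Coefficient {N : ℕ} (α : Vec ℕ N) where
  open PathCount (δ α) public

  e*XP-coefficient : ∀ l k → (e l N *P X (P k) N) α ≡ pos (ePath l k)
  e*XP-coefficient l k = begin
    sumℤ (map (λ β → e l N β ℤ.* X (P k) N (zipWith _∸_ α β)) (below α))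
      ≡⟨ cong sumℤ (LP.map-cong term (below α)) ⟩
    sumℤ (map (λ β → pos (when (is01 β) (F β))) (below α))
      ≡⟨ sumℤ-pos (below α) _ ⟩
    pos (∑List (below α) (λ β → when (is01 β) (F β)))
      ≡⟨ cong pos (∑List-below α F) ⟩
    pos (∑Subsets N (λ β → when (β ≤ᵛ α) (F β)))
      ≡⟨ cong pos (∑-cong (∑Subsets-isSummation N) complement) ⟩
    pos (ePath l k) ∎
    where
    Col = ∑Colourings-isSummation N k
    F : Vec ℕ N → ℕ
    F β = when (degree β ≡ᵇ l) (∑Colourings N k (λ κ → when (isPathColouring κ) (δ (zipWith _∸_ α β) (monomial κ))))
    indicator-* : ∀ b n → (if b then 1ℤ else 0ℤ) ℤ.* pos n ≡ pos (when b n)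
    indicator-* true  n = ZP.*-identityˡ (pos n)
    indicator-* false n = refl
    term : ∀ β → e l N β ℤ.* X (P k) N (zipWith _∸_ α β) ≡ pos (when (is01 β) (F β))
    term β = begin
      e l N β ℤ.* X (P k) N (zipWith _∸_ α β)
        ≡⟨ cong (e l N β ℤ.*_) (trans (X-coefficient (P k) _)
              (cong pos (∑-cong Col (λ κ → cong (λ b → when b (δ (zipWith _∸_ α β) (monomial κ))) (isProper-path k κ))))) ⟩
      e l N β ℤ.* pos (∑Colourings N k (λ κ → when (isPathColouring κ) (δ (zipWith _∸_ α β) (monomial κ))))
        ≡⟨ indicator-* (is01 β ∧ (degree β ≡ᵇ l)) _ ⟩
      pos (when (is01 β ∧ (degree β ≡ᵇ l)) _)
        ≡⟨ cong pos (when-∧ (is01 β) (degree β ≡ᵇ l) _) ⟩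
      pos (when (is01 β) (F β)) ∎
    complement : ∀ β → when (β ≤ᵛ α) (F β)
      ≡ when (degree β ≡ᵇ l) (∑Colourings N k (λ κ → when (isPathColouring κ) (δ α (β +ᵛ monomial κ))))
    complement β = trans (when-comm (β ≤ᵛ α) (degree β ≡ᵇ l) _) (cong (when (degree β ≡ᵇ l))
      (trans (sym (∑-when Col (β ≤ᵛ α) _)) (∑-cong Col (λ κ →
        trans (when-comm (β ≤ᵛ α) (isPathColouring κ) _) (cong (when (isPathColouring κ)) (byDifference (monomial κ)))))))
      where
      byDifference : ∀ γ → when (β ≤ᵛ α) (δ (zipWith _∸_ α β) γ) ≡ δ α (β +ᵛ γ)
      byDifference γ = trans (sym (when-∧ (β ≤ᵛ α) (γ ==ᵛ zipWith _∸_ α β) 1))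
                             (cong (λ b → when b 1) (≤ᵛ∧==ᵛ∸≡+ᵛ==ᵛ β γ α))

  e-coefficient : ∀ n → e n N α ≡ pos (ePath n 0)
  e-coefficient n = sym (begin
    pos (ePath n 0)
      ≡⟨ cong pos (∑-cong (∑Subsets-isSummation N) (λ S → cong (λ v → when (degree S ≡ᵇ n) (δ α v)) (+ᵛ-identityʳ S))) ⟩
    pos (∑Subsets N (λ S → when (degree S ≡ᵇ n) (δ α S)))
      ≡⟨ cong pos (∑Subsets-==ᵛ α (λ S → degree S ≡ᵇ n)) ⟩
    pos (when (is01 α) (when (degree α ≡ᵇ n) 1))
      ≡⟨ indicator (is01 α) (degree α ≡ᵇ n) ⟩
    e n N α ∎)
    where
    indicator : ∀ b c → pos (when b (when c 1)) ≡ (if b ∧ c then 1ℤ else 0ℤ)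
    indicator true  true  = refl
    indicator true  false = refl
    indicator false c     = refl

  lhs-coefficient : ∀ n a → lhs n a N α ≡ sumℤ (map (eTerm n) (upTo (suc a)))
  lhs-coefficient n a = go (upTo (suc a))
    where
    go : ∀ ls → List.foldr (λ l acc → ((1ℤ ℤ.- pos l) ·P (e l N *P X (P (n ∸ l)) N)) +P acc) 0P ls α
              ≡ sumℤ (map (eTerm n) ls)
    go []       = refl
    go (l ∷ ls) = cong₂ ℤ._+_ (cong ((1ℤ ℤ.- pos l) ℤ.*_) (e*XP-coefficient l (n ∸ l))) (go ls)

  lhs≡ePathOutside : ∀ n a → a ≤ n → lhs n a N α ≡ pos (ePathOutside a (n ∸ a))
  lhs≡ePathOutside n a a≤n = trans (lhs-coefficient n a) (∑eTerm≡ePathOutside n a a≤n)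

  lollipop-coefficient : ∀ a m → X (Lollipop (suc a) m) N α ≡ pos (a ! * ePathOutside a (suc m))
  lollipop-coefficient a m = trans (X-coefficient (Lollipop (suc a) m) α) (cong pos (trans
    (∑-cong (∑Colourings-isSummation N (suc a + m)) (λ κ → cong (λ b → when b (δ α (monomial κ))) (isProper-lollipop m a κ)))
    (LollipopCount.lollipopCount (δ α) m a)))

lemma4p4 : (n a : ℕ) → a ≤ n → (N : ℕ) →
    ((a < n → ((pos (a !)) ·P lhs n a N) ≈P X (Lollipop (suc a) (n ∸ suc a)) N)
    × (a ≡ n → lhs n a N ≈P e n N))
lemma4p4 n a a≤n N = lollipopCase , completeCase
  where
  lollipopCase : a < n → (pos (a !) ·P lhs n a N) ≈P X (Lollipop (suc a) (n ∸ suc a)) N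
  lollipopCase a<n α = begin
    pos (a !) ℤ.* lhs n a N α
      ≡⟨ cong (pos (a !) ℤ.*_) (lhs≡ePathOutside n a a≤n) ⟩
    pos (a !) ℤ.* pos (ePathOutside a (n ∸ a))
      ≡⟨ cong (λ j → pos (a !) ℤ.* pos (ePathOutside a j)) (∸≡suc∸suc a<n) ⟩
    pos (a !) ℤ.* pos (ePathOutside a (suc (n ∸ suc a)))
      ≡⟨ sym (ZP.pos-* (a !) _) ⟩
    pos (a ! * ePathOutside a (suc (n ∸ suc a)))
      ≡⟨ sym (lollipop-coefficient a (n ∸ suc a)) ⟩
    X (Lollipop (suc a) (n ∸ suc a)) N α ∎
    where open Coefficient α
  completeCase : a ≡ n → lhs n a N ≈P e n N
  completeCase refl α = begin
    lhs n n N α                  ≡⟨ lhs≡ePathOutside n n a≤n ⟩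
    pos (ePathOutside n (n ∸ n)) ≡⟨ cong (λ j → pos (ePathOutside n j)) (NP.n∸n≡0 n) ⟩
    pos (ePath n 0)              ≡⟨ sym (e-coefficient n) ⟩
    e n N α ∎
    where open Coefficient α
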